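{- Let $k \geq 1$ and let $Q$ be a regular polygon with $2k+1$ sides. If $t$ is an integer with $1 \leq t < k$, then $O_{2k+1}(2t+1) = 0$, i.e. there is no periodic orbit of period $2t+1$ perpendicularly inscribed in $Q$ that passes through side $1$.
   Context: Let $Q$ be a regular polygon with $2k+1$ sides, labeled $1,2,\ldots,2k+1$ counterclockwise. A polygonal chain $(A_1,\ldots,A_n)$ is perpendicularly inscribed in $Q$ if every $A_i$ lies on a side of $Q$ and each segment $A_iA_{i+1}$ is perpendicular to the side of $Q$ on which $A_i$ lies. A periodic orbit of period $n$ is such a chain that closes after $n$ steps, i.e. $A_{n+1}=A_1$ (a polygon perpendicularly inscribed in $Q$). $O_{2k+1}(n)$ denotes the number of periodic orbits of period $n$ in $Q$ having a vertex on side $1$, where orbits are distinguished by the sequence of sides they visit starting from side $1$, two such side-sequences that are cyclic permutations of one another are counted as the same orbit, and degenerate sequences that visit only two sides of $Q$ (which do not produce genuine periodic orbits) are not counted. -}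

module Defs where

open import Level using (0ℓ)
open import Data.Nat as ℕ using (ℕ; suc; _+_; _*_)
open import Data.Nat.DivMod using (_%_; m%n<n)
open import Data.Fin using (Fin; toℕ; fromℕ<)
open import Data.Product using (Σ; ∃; ∃-syntax; _×_; _,_)
open import Data.Sum using (_⊎_)
open import Data.Empty using (⊥)
open import Relation.Nullary using (¬_)
open import Relation.Binary.PropositionalEquality using (_≡_)
open import Relation.Binary.Structures using (IsStrictTotalOrder)
open import Algebra.Structures using (IsCommutativeRing)

-- The real numbers, axiomatised as a Dedekind-complete ordered field
-- (this characterises ℝ up to isomorphism).

record RealField : Set₁ where
  infixl 6 _+ᴿ_ _-ᴿ_
  infixl 7 _*ᴿ_
  infix 4 _<ᴿ_ _≤ᴿ_
  field
    Carrier : Set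
    _+ᴿ_ _*ᴿ_ : Carrier → Carrier → Carrier
    -ᴿ_ : Carrier → Carrier
    0ᴿ 1ᴿ : Carrier
    _<ᴿ_ : Carrier → Carrier → Set
    isCommutativeRing : IsCommutativeRing _≡_ _+ᴿ_ _*ᴿ_ -ᴿ_ 0ᴿ 1ᴿ
    0≢1 : ¬ (0ᴿ ≡ 1ᴿ)
    inverse : ∀ x → ¬ (x ≡ 0ᴿ) → ∃[ y ] (x *ᴿ y ≡ 1ᴿ)
    isStrictTotalOrder : IsStrictTotalOrder _≡_ _<ᴿ_
    +-mono-< : ∀ {x y} z → x <ᴿ y → x +ᴿ z <ᴿ y +ᴿ z
    *-pos : ∀ {x y} → 0ᴿ <ᴿ x → 0ᴿ <ᴿ y → 0ᴿ <ᴿ x *ᴿ y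

  _≤ᴿ_ : Carrier → Carrier → Set
  x ≤ᴿ y = x <ᴿ y ⊎ x ≡ y

  _-ᴿ_ : Carrier → Carrier → Carrier
  x -ᴿ y = x +ᴿ (-ᴿ y)

  field
    complete : (P : Carrier → Set) → ∃ P → (∃[ b ] (∀ x → P x → x ≤ᴿ b)) →
               ∃[ s ] ((∀ x → P x → x ≤ᴿ s) ×
                       (∀ b → (∀ x → P x → x ≤ᴿ b) → s ≤ᴿ b))

next : ∀ {n} → Fin (suc n) → Fin (suc n)
next {n} i = fromℕ< (m%n<n (suc (toℕ i)) (suc n))

module Geometry (R : RealField) where
  open RealField R

  Point : Set
  Point = Carrier × Carrier

  _⊖_ : Point → Point → Point
  (x₁ , y₁) ⊖ (x₂ , y₂) = (x₁ -ᴿ x₂ , y₁ -ᴿ y₂)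

  dot : Point → Point → Carrier
  dot (x₁ , y₁) (x₂ , y₂) = x₁ *ᴿ x₂ +ᴿ y₁ *ᴿ y₂

  cross : Point → Point → Carrier
  cross (x₁ , y₁) (x₂ , y₂) = x₁ *ᴿ y₂ -ᴿ y₁ *ᴿ x₂

  -- A regular polygon with n = suc m sides, vertices V 0, …, V m listed
  -- counterclockwise; side i is the segment from V i to V (next i).
  record RegularPolygon (m : ℕ) : Set where
    field
      V : Fin (suc m) → Point

    edge : Fin (suc m) → Point
    edge i = V (next i) ⊖ V i

    field
      edge-pos   : ∀ i → 0ᴿ <ᴿ dot (edge i) (edge i)
      equal-side : ∀ i j → dot (edge i) (edge i) ≡ dot (edge j) (edge j)
      -- all (exterior, hence interior) angles are equal
      equal-dot   : ∀ i j → dot (edge i) (edge (next i)) ≡ dot (edge j) (edge (next j))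
      equal-cross : ∀ i j → cross (edge i) (edge (next i)) ≡ cross (edge j) (edge (next j))
      -- strictly convex and counterclockwise: every other vertex lies
      -- strictly to the left of each side
      convex-ccw : ∀ i j → ¬ (j ≡ i) → ¬ (j ≡ next i) → 0ᴿ <ᴿ cross (edge i) (V j ⊖ V i)

    OnSide : Point → Fin (suc m) → Set
    OnSide A i = ∃[ λ' ] ((0ᴿ ≤ᴿ λ') × (λ' ≤ᴿ 1ᴿ) ×
                 (A ≡ (proj-x (V i) +ᴿ λ' *ᴿ proj-x (edge i) ,
                       proj-y (V i) +ᴿ λ' *ᴿ proj-y (edge i))))
      where
        proj-x proj-y : Point → Carrier
        proj-x (x , _) = x
        proj-y (_ , y) = y

    record PeriodicOrbit (p : ℕ) : Set where
      field
        s : Fin (suc p) → Fin (suc m)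
        A : Fin (suc p) → Point
        on-side : ∀ j → OnSide (A j) (s j)
        nondeg  : ∀ j → ¬ (A (next j) ≡ A j)
        perp    : ∀ j → dot (A (next j) ⊖ A j) (edge (s j)) ≡ 0ᴿ

    VisitsThreeSides : ∀ {p} → PeriodicOrbit p → Set
    VisitsThreeSides O = ∃[ a ] ∃[ b ] ∃[ c ]
      (¬ (s a ≡ s b) × ¬ (s b ≡ s c) × ¬ (s a ≡ s c))
      where open PeriodicOrbit O

    -- the orbit has a vertex on side 1 (= Fin index zero)
    PassesSide1 : ∀ {p} → PeriodicOrbit p → Set
    PassesSide1 O = ∃[ j ] (s j ≡ Fin.zero)
      where open PeriodicOrbit O
            import Data.Fin as Fin

{-# OPTIONS --safe #-}
-- Identify the plane with ℂ.  Consecutive sides of the regular (2k+1)-gon differ by a rotation ζ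
-- (ζ = e^{2iθ}, θ = π/(2k+1)), and the vertex r steps after a side is reached along the power sum
-- 1 + ζ + ⋯ + ζ^(r-1).  Convexity puts these power sums to the left of the side, which forces
-- sin jθ > 0 for j ≤ 2k and hence cos 2θ + ⋯ + cos 2qθ > 0 for q < k.  Consequently the foot, on
-- the line of side i, of the perpendicular from a point of side i + r lies outside side i (or is a
-- common vertex of the two sides) unless r ∈ {k, k+1}, and symmetrically.  Along a periodic orbit
-- the side index therefore advances by k or k+1 modulo 2k+1 at every step; after 2t+1 steps it has
-- advanced by (2t+1)k + a with 0 ≤ a ≤ 2t+1, which lies strictly between t(2k+1) and (t+1)(2k+1)
-- when t < k, so the orbit cannot close.
module Submission where

open import Algebra.Bundles using (CommutativeRing)
open import Algebra.Core using (Op₁; Op₂)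
open import Algebra.Structures using (IsCommutativeRing)
open import Data.Empty using (⊥; ⊥-elim)
open import Data.Fin as Fin using (Fin; toℕ)
import Data.Fin.Properties as Fin
open import Data.Integer as ℤ using (ℤ; -[1+_]; _◃_; sign; ∣_∣)
import Data.Integer.Properties as ℤ
open import Data.List using ([]; _∷_)
open import Data.Maybe using (Maybe; just; nothing)
open import Data.Nat as ℕ using (ℕ; zero; suc; _∸_; _≤_; _<_; z≤n; s≤s)
open import Data.Nat.DivMod using (_%_; _/_; m%n<n; m<n⇒m%n≡m; %-distribˡ-+; m%n%n≡m%n; [m+n]%n≡m%n; m≡m%n+[m/n]*n)
import Data.Nat.Properties as ℕ
import Data.Nat.Tactic.RingSolver as ℕ-Solver
open import Data.Sign as Sign using (Sign)
open import Data.Sum using (_⊎_; inj₁; inj₂)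
open import Relation.Binary.Definitions using (tri<; tri≈; tri>)
open import Relation.Binary.PropositionalEquality
open import Relation.Binary.Structures using (IsStrictTotalOrder)
open import Relation.Nullary using (yes; no)

open import Defs

-- The ring solver of the standard library needs coefficients with decidable equality; we use ℤ
-- through its canonical map into any commutative ring.
module IntegerCoefficientSolver
  {a} {A : Set a} {add mul : Op₂ A} {neg : Op₁ A} {𝟘 𝟙 : A}
  (isCommutativeRing : IsCommutativeRing _≡_ add mul neg 𝟘 𝟙) where

  commutativeRing : CommutativeRing a a
  commutativeRing = record { isCommutativeRing = isCommutativeRing }

  open CommutativeRing commutativeRing
    using (_+_; _*_; -_; _-_; 0#; 1#; +-identityˡ; +-identityʳ; +-comm; *-identityˡ; *-identityʳ; zeroʳ;
           -‿inverseʳ; ring; semiring; +-abelianGroup; +-commutativeSemigroup;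
           *-commutativeSemigroup)
  open import Algebra.Properties.Ring ring using (-1*x≈-x; -‿distribʳ-*)
  open import Algebra.Properties.AbelianGroup +-abelianGroup using (ε⁻¹≈ε; ⁻¹-involutive; ⁻¹-∙-comm)
  open import Algebra.Properties.CommutativeSemigroup +-commutativeSemigroup
    using () renaming (interchange to +-interchange)
  open import Algebra.Properties.CommutativeSemigroup *-commutativeSemigroup
    using () renaming (interchange to *-interchange)
  open import Algebra.Properties.Semiring.Mult.TCOptimised semiring
    using (_×_; 1+×; ×-homo-+; ×1-homo-*)
  open import Algebra.Solver.Ring.AlmostCommutativeRing
    using (AlmostCommutativeRing; fromCommutativeRing; _-Raw-AlmostCommutative⟶_)
  open ≡-Reasoning

  fromℤ : ℤ → A
  fromℤ (ℤ.+ n)    = n × 1#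
  fromℤ -[1+ n ] = - (suc n × 1#)

  fromℤ-⊖ : ∀ m n → fromℤ (m ℤ.⊖ n) ≡ m × 1# - n × 1#
  fromℤ-⊖ zero    zero    = sym (trans (cong (0# +_) ε⁻¹≈ε) (+-identityʳ 0#))
  fromℤ-⊖ zero    (suc n) = sym (+-identityˡ _)
  fromℤ-⊖ (suc m) zero    = sym (trans (cong (suc m × 1# +_) ε⁻¹≈ε) (+-identityʳ _))
  fromℤ-⊖ (suc m) (suc n) = begin
    fromℤ (suc m ℤ.⊖ suc n)       ≡⟨ cong fromℤ (ℤ.[1+m]⊖[1+n]≡m⊖n m n) ⟩
    fromℤ (m ℤ.⊖ n)               ≡⟨ fromℤ-⊖ m n ⟩
    M - N                         ≡⟨ sym (+-identityˡ (M - N)) ⟩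
    0# + (M - N)                  ≡⟨ cong (_+ (M - N)) (sym (-‿inverseʳ 1#)) ⟩
    (1# - 1#) + (M - N)           ≡⟨ +-interchange 1# (- 1#) M (- N) ⟩
    (1# + M) + (- 1# + - N)       ≡⟨ cong ((1# + M) +_) (⁻¹-∙-comm 1# N) ⟩
    (1# + M) - (1# + N)           ≡⟨ sym (cong₂ _-_ (1+× m 1#) (1+× n 1#)) ⟩
    suc m × 1# - suc n × 1#       ∎
    where
    M N : A
    M = m × 1#
    N = n × 1#

  fromℤ-+ : ∀ i j → fromℤ (i ℤ.+ j) ≡ fromℤ i + fromℤ j
  fromℤ-+ (ℤ.+ m)    (ℤ.+ n)    = ×-homo-+ 1# m n
  fromℤ-+ (ℤ.+ m)    -[1+ n ] = fromℤ-⊖ m (suc n)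
  fromℤ-+ -[1+ m ] (ℤ.+ n)    = trans (fromℤ-⊖ n (suc m)) (+-comm _ _)
  fromℤ-+ -[1+ m ] -[1+ n ] = begin
    - (suc (suc (m ℕ.+ n)) × 1#)       ≡⟨ cong (λ x → - (suc x × 1#)) (sym (ℕ.+-suc m n)) ⟩
    - ((suc m ℕ.+ suc n) × 1#)         ≡⟨ cong -_ (×-homo-+ 1# (suc m) (suc n)) ⟩
    - (suc m × 1# + suc n × 1#)        ≡⟨ sym (⁻¹-∙-comm _ _) ⟩
    - (suc m × 1#) + - (suc n × 1#)    ∎

  fromℤ-neg : ∀ i → fromℤ (ℤ.- i) ≡ - fromℤ i
  fromℤ-neg (ℤ.+ zero)  = sym ε⁻¹≈ε
  fromℤ-neg (ℤ.+ suc n) = refl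
  fromℤ-neg -[1+ n ]  = sym (⁻¹-involutive _)

  fromSign : Sign → A
  fromSign Sign.+ = 1#
  fromSign Sign.- = - 1#

  fromSign-* : ∀ s t → fromSign (s Sign.* t) ≡ fromSign s * fromSign t
  fromSign-* Sign.+ t      = sym (*-identityˡ _)
  fromSign-* Sign.- Sign.+ = sym (*-identityʳ _)
  fromSign-* Sign.- Sign.- = begin
    1#                  ≡⟨ sym (⁻¹-involutive 1#) ⟩
    - (- 1#)            ≡⟨ cong -_ (sym (-1*x≈-x 1#)) ⟩
    - (- 1# * 1#)       ≡⟨ -‿distribʳ-* (- 1#) 1# ⟩
    - 1# * - 1#         ∎

  fromℤ-◃ : ∀ s n → fromℤ (s ◃ n) ≡ fromSign s * (n × 1#)
  fromℤ-◃ s      zero    = sym (zeroʳ _)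
  fromℤ-◃ Sign.+ (suc n) = sym (*-identityˡ _)
  fromℤ-◃ Sign.- (suc n) = sym (-1*x≈-x _)

  fromℤ-* : ∀ i j → fromℤ (i ℤ.* j) ≡ fromℤ i * fromℤ j
  fromℤ-* i j = begin
    fromℤ (sign i Sign.* sign j ◃ ∣ i ∣ ℕ.* ∣ j ∣)
      ≡⟨ fromℤ-◃ (sign i Sign.* sign j) (∣ i ∣ ℕ.* ∣ j ∣) ⟩
    fromSign (sign i Sign.* sign j) * ((∣ i ∣ ℕ.* ∣ j ∣) × 1#)
      ≡⟨ cong₂ _*_ (fromSign-* (sign i) (sign j)) (×1-homo-* ∣ i ∣ ∣ j ∣) ⟩
    (fromSign (sign i) * fromSign (sign j)) * ((∣ i ∣ × 1#) * (∣ j ∣ × 1#))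
      ≡⟨ *-interchange _ _ _ _ ⟩
    (fromSign (sign i) * (∣ i ∣ × 1#)) * (fromSign (sign j) * (∣ j ∣ × 1#))
      ≡⟨ sym (cong₂ _*_ (signAbs i) (signAbs j)) ⟩
    fromℤ i * fromℤ j ∎
    where
    signAbs : ∀ i → fromℤ i ≡ fromSign (sign i) * (∣ i ∣ × 1#)
    signAbs i = trans (cong fromℤ (sym (ℤ.◃-inverse i))) (fromℤ-◃ (sign i) ∣ i ∣)

  almostCommutativeRing : AlmostCommutativeRing a a
  almostCommutativeRing = fromCommutativeRing commutativeRing

  fromℤ-homomorphism : ℤ.+-*-rawRing -Raw-AlmostCommutative⟶ almostCommutativeRing
  fromℤ-homomorphism = record
    { ⟦_⟧ = fromℤ ; +-homo = fromℤ-+ ; *-homo = fromℤ-* ; -‿homo = fromℤ-neg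
    ; 0-homo = refl ; 1-homo = refl }

  fromℤ-≟ : ∀ i j → Maybe (fromℤ i ≡ fromℤ j)
  fromℤ-≟ i j with i ℤ.≟ j
  ... | yes i≡j = just (cong fromℤ i≡j)
  ... | no  _   = nothing

  open import Algebra.Solver.Ring ℤ.+-*-rawRing almostCommutativeRing fromℤ-homomorphism fromℤ-≟ public

  :0 :1 : ∀ {n} → Polynomial n
  :0 = con (ℤ.+ 0)
  :1 = con (ℤ.+ 1)

-- Opened only here: inside IntegerCoefficientSolver these names are the ring's, and _×_ is n × 1#.
open import Data.Nat using (_+_; _*_)
open import Data.Product using (∃; _×_; _,_; proj₁; proj₂)

module OrderedFieldProperties (R : RealField) where
  open RealField R public
  open IntegerCoefficientSolver isCommutativeRing public
  open CommutativeRing commutativeRing public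
    using (+-assoc; +-comm; *-comm; +-identityˡ; +-identityʳ; *-identityˡ; *-identityʳ;
           zeroˡ; zeroʳ; distribˡ; distribʳ; -‿inverseʳ)
  open import Algebra.Properties.Group (CommutativeRing.+-group commutativeRing)
    using (x∙y⁻¹≈ε⇒x≈y)
  open IsStrictTotalOrder isStrictTotalOrder
    using (compare; irrefl; asym) renaming (trans to <-trans)

  private
    variable
      a b x y : Carrier

  x<y⇒0<y-x : x <ᴿ y → 0ᴿ <ᴿ y -ᴿ x
  x<y⇒0<y-x {x} {y} x<y = subst (_<ᴿ y -ᴿ x) (-‿inverseʳ x) (+-mono-< (-ᴿ x) x<y)

  x<0⇒0<-x : x <ᴿ 0ᴿ → 0ᴿ <ᴿ -ᴿ x
  x<0⇒0<-x {x} x<0 = subst (0ᴿ <ᴿ_) (+-identityˡ (-ᴿ x)) (x<y⇒0<y-x x<0)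

  x≤1⇒0≤1-x : x ≤ᴿ 1ᴿ → 0ᴿ ≤ᴿ 1ᴿ -ᴿ x
  x≤1⇒0≤1-x (inj₁ x<1)  = inj₁ (x<y⇒0<y-x x<1)
  x≤1⇒0≤1-x (inj₂ refl) = inj₂ (sym (-‿inverseʳ 1ᴿ))

  x-y≡0⇒x≡y : x -ᴿ y ≡ 0ᴿ → x ≡ y
  x-y≡0⇒x≡y = x∙y⁻¹≈ε⇒x≈y _ _

  pos⇒≢0 : 0ᴿ <ᴿ x → x ≢ 0ᴿ
  pos⇒≢0 0<x refl = irrefl refl 0<x

  +-pos : 0ᴿ <ᴿ x → 0ᴿ <ᴿ y → 0ᴿ <ᴿ x +ᴿ y
  +-pos {x} {y} 0<x 0<y = <-trans 0<y (subst (_<ᴿ x +ᴿ y) (+-identityˡ y) (+-mono-< y 0<x))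

  +-pos-nonNeg : 0ᴿ <ᴿ x → 0ᴿ ≤ᴿ y → 0ᴿ <ᴿ x +ᴿ y
  +-pos-nonNeg 0<x (inj₁ 0<y)    = +-pos 0<x 0<y
  +-pos-nonNeg {x} 0<x (inj₂ refl) = subst (0ᴿ <ᴿ_) (sym (+-identityʳ x)) 0<x

  +-nonNeg : 0ᴿ ≤ᴿ x → 0ᴿ ≤ᴿ y → 0ᴿ ≤ᴿ x +ᴿ y
  +-nonNeg (inj₁ 0<x) 0≤y = inj₁ (+-pos-nonNeg 0<x 0≤y)
  +-nonNeg {y = y} (inj₂ refl) 0≤y = subst (0ᴿ ≤ᴿ_) (sym (+-identityˡ y)) 0≤y

  *-nonNeg : 0ᴿ ≤ᴿ x → 0ᴿ ≤ᴿ y → 0ᴿ ≤ᴿ x *ᴿ y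
  *-nonNeg (inj₁ 0<x) (inj₁ 0<y)        = inj₁ (*-pos 0<x 0<y)
  *-nonNeg {x} (inj₁ _) (inj₂ refl)     = inj₂ (sym (zeroʳ x))
  *-nonNeg {y = y} (inj₂ refl) _        = inj₂ (sym (zeroˡ y))

  0<1 : 0ᴿ <ᴿ 1ᴿ
  0<1 with compare 0ᴿ 1ᴿ
  ... | tri< 0<1 _ _ = 0<1
  ... | tri≈ _ 0≡1 _ = ⊥-elim (0≢1 0≡1)
  ... | tri> _ _ 1<0 = ⊥-elim (asym (subst (0ᴿ <ᴿ_) -1*-1≡1 (*-pos 0<-1 0<-1)) 1<0)
    where
    0<-1 : 0ᴿ <ᴿ -ᴿ 1ᴿ
    0<-1 = x<0⇒0<-x 1<0
    -1*-1≡1 : -ᴿ 1ᴿ *ᴿ -ᴿ 1ᴿ ≡ 1ᴿ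
    -1*-1≡1 = solve 0 (:- :1 :* :- :1 := :1) refl

  *-cancelˡ-pos : 0ᴿ <ᴿ a → 0ᴿ <ᴿ a *ᴿ b → 0ᴿ <ᴿ b
  *-cancelˡ-pos {a} {b} 0<a 0<ab with compare b 0ᴿ
  ... | tri< b<0 _ _ = ⊥-elim (irrefl ab-ab≡0 (+-pos 0<ab (subst (0ᴿ <ᴿ_) a*-b≡-ab (*-pos 0<a (x<0⇒0<-x b<0)))))
    where
    a*-b≡-ab : a *ᴿ -ᴿ b ≡ -ᴿ (a *ᴿ b)
    a*-b≡-ab = solve 2 (λ a b → a :* :- b := :- (a :* b)) refl a b
    ab-ab≡0 : 0ᴿ ≡ a *ᴿ b -ᴿ a *ᴿ b
    ab-ab≡0 = sym (-‿inverseʳ (a *ᴿ b))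
  ... | tri≈ _ refl _ = ⊥-elim (irrefl (sym (zeroʳ a)) 0<ab)
  ... | tri> _ _ 0<b  = 0<b

  *-cancelˡ-≡0 : a ≢ 0ᴿ → a *ᴿ b ≡ 0ᴿ → b ≡ 0ᴿ
  *-cancelˡ-≡0 {a} {b} a≢0 ab≡0 with inverse a a≢0
  ... | a⁻¹ , aa⁻¹≡1 = begin
    b                  ≡⟨ sym (*-identityʳ b) ⟩
    b *ᴿ 1ᴿ            ≡⟨ cong (b *ᴿ_) (sym aa⁻¹≡1) ⟩
    b *ᴿ (a *ᴿ a⁻¹)    ≡⟨ solve 3 (λ a b a⁻¹ → b :* (a :* a⁻¹) := (a :* b) :* a⁻¹) refl a b a⁻¹ ⟩
    (a *ᴿ b) *ᴿ a⁻¹    ≡⟨ cong (_*ᴿ a⁻¹) ab≡0 ⟩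
    0ᴿ *ᴿ a⁻¹          ≡⟨ zeroˡ a⁻¹ ⟩
    0ᴿ                 ∎
    where open ≡-Reasoning

  +-nonNeg-≡0ˡ : 0ᴿ ≤ᴿ a → 0ᴿ ≤ᴿ b → a +ᴿ b ≡ 0ᴿ → a ≡ 0ᴿ
  +-nonNeg-≡0ˡ (inj₁ 0<a)  0≤b a+b≡0 = ⊥-elim (irrefl (sym a+b≡0) (+-pos-nonNeg 0<a 0≤b))
  +-nonNeg-≡0ˡ (inj₂ refl) _   _     = refl

  +-nonNeg-≡0ʳ : 0ᴿ ≤ᴿ a → 0ᴿ ≤ᴿ b → a +ᴿ b ≡ 0ᴿ → b ≡ 0ᴿ
  +-nonNeg-≡0ʳ 0≤a 0≤b a+b≡0 = +-nonNeg-≡0ˡ 0≤b 0≤a (trans (+-comm _ _) a+b≡0)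

  convex-pos : ∀ {l} → 0ᴿ <ᴿ a → 0ᴿ <ᴿ b → 0ᴿ ≤ᴿ l → 0ᴿ ≤ᴿ 1ᴿ -ᴿ l →
               0ᴿ <ᴿ (1ᴿ -ᴿ l) *ᴿ a +ᴿ l *ᴿ b
  convex-pos 0<a 0<b (inj₁ 0<l) 0≤1-l =
    subst (0ᴿ <ᴿ_) (+-comm _ _) (+-pos-nonNeg (*-pos 0<l 0<b) (*-nonNeg 0≤1-l (inj₁ 0<a)))
  convex-pos {a} {b} 0<a _ (inj₂ refl) _ =
    subst (0ᴿ <ᴿ_) (solve 2 (λ a b → a := (:1 :- :0) :* a :+ :0 :* b) refl a b) 0<a

module ComplexPlane (R : RealField) where
  open OrderedFieldProperties R public
  open Geometry R public using (Point; _⊖_; dot; cross)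
  open ≡-Reasoning

  infixl 6 _⊕_
  infixl 7 _⊗_
  infixl 8 _^_

  re im : Point → Carrier
  re = proj₁
  im = proj₂

  _⊕_ _⊗_ : Point → Point → Point
  (a , b) ⊕ (c , d) = (a +ᴿ c , b +ᴿ d)
  (a , b) ⊗ (c , d) = (a *ᴿ c -ᴿ b *ᴿ d , a *ᴿ d +ᴿ b *ᴿ c)

  1ℂ : Point
  1ℂ = (1ᴿ , 0ᴿ)

  negate : Point → Point
  negate (a , b) = (-ᴿ a , -ᴿ b)

  ∣_∣² : Point → Carrier
  ∣ z ∣² = dot z z

  _^_ : Point → ℕ → Point
  z ^ zero  = 1ℂ
  z ^ suc r = z ^ r ⊗ z

  powerSum : Point → ℕ → Point
  powerSum z zero    = (0ᴿ , 0ᴿ)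
  powerSum z (suc r) = powerSum z r ⊕ z ^ r

  ⊗-assoc : ∀ x y z → (x ⊗ y) ⊗ z ≡ x ⊗ (y ⊗ z)
  ⊗-assoc (a , b) (c , d) (e , f) = cong₂ _,_
    (solve 6 (λ a b c d e f → (a :* c :- b :* d) :* e :- (a :* d :+ b :* c) :* f
                            := a :* (c :* e :- d :* f) :- b :* (c :* f :+ d :* e)) refl a b c d e f)
    (solve 6 (λ a b c d e f → (a :* c :- b :* d) :* f :+ (a :* d :+ b :* c) :* e
                            := a :* (c :* f :+ d :* e) :+ b :* (c :* e :- d :* f)) refl a b c d e f)

  ⊗-comm : ∀ x y → x ⊗ y ≡ y ⊗ x
  ⊗-comm (a , b) (c , d) = cong₂ _,_
    (solve 4 (λ a b c d → a :* c :- b :* d := c :* a :- d :* b) refl a b c d)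
    (solve 4 (λ a b c d → a :* d :+ b :* c := c :* b :+ d :* a) refl a b c d)

  ⊗-identityˡ : ∀ z → 1ℂ ⊗ z ≡ z
  ⊗-identityˡ (a , b) = cong₂ _,_
    (solve 2 (λ a b → :1 :* a :- :0 :* b := a) refl a b)
    (solve 2 (λ a b → :1 :* b :+ :0 :* a := b) refl a b)

  ⊗-identityʳ : ∀ z → z ⊗ 1ℂ ≡ z
  ⊗-identityʳ z = trans (⊗-comm z 1ℂ) (⊗-identityˡ z)

  ⊗-interchange : ∀ w x y z → (w ⊗ x) ⊗ (y ⊗ z) ≡ (w ⊗ y) ⊗ (x ⊗ z)
  ⊗-interchange w x y z = begin
    (w ⊗ x) ⊗ (y ⊗ z) ≡⟨ ⊗-assoc w x (y ⊗ z) ⟩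
    w ⊗ (x ⊗ (y ⊗ z)) ≡⟨ cong (w ⊗_) (sym (⊗-assoc x y z)) ⟩
    w ⊗ ((x ⊗ y) ⊗ z) ≡⟨ cong (λ u → w ⊗ (u ⊗ z)) (⊗-comm x y) ⟩
    w ⊗ ((y ⊗ x) ⊗ z) ≡⟨ cong (w ⊗_) (⊗-assoc y x z) ⟩
    w ⊗ (y ⊗ (x ⊗ z)) ≡⟨ sym (⊗-assoc w y (x ⊗ z)) ⟩
    (w ⊗ y) ⊗ (x ⊗ z) ∎

  ^-homo-⊗ : ∀ z m n → z ^ (m + n) ≡ z ^ m ⊗ z ^ n
  ^-homo-⊗ z zero    n = sym (⊗-identityˡ (z ^ n))
  ^-homo-⊗ z (suc m) n = begin
    z ^ (m + n) ⊗ z       ≡⟨ cong (_⊗ z) (^-homo-⊗ z m n) ⟩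
    z ^ m ⊗ z ^ n ⊗ z     ≡⟨ ⊗-assoc (z ^ m) (z ^ n) z ⟩
    z ^ m ⊗ (z ^ n ⊗ z)   ≡⟨ cong (z ^ m ⊗_) (⊗-comm (z ^ n) z) ⟩
    z ^ m ⊗ (z ⊗ z ^ n)   ≡⟨ sym (⊗-assoc (z ^ m) z (z ^ n)) ⟩
    z ^ m ⊗ z ⊗ z ^ n     ∎

  ^-distrib-⊗ : ∀ y z r → (y ⊗ z) ^ r ≡ y ^ r ⊗ z ^ r
  ^-distrib-⊗ y z zero    = sym (⊗-identityˡ 1ℂ)
  ^-distrib-⊗ y z (suc r) = trans (cong (_⊗ (y ⊗ z)) (^-distrib-⊗ y z r)) (⊗-interchange _ _ _ _)

  ∣⊗∣² : ∀ y z → ∣ y ⊗ z ∣² ≡ ∣ y ∣² *ᴿ ∣ z ∣²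
  ∣⊗∣² (a , b) (c , d) = solve 4 (λ a b c d →
      (a :* c :- b :* d) :* (a :* c :- b :* d) :+ (a :* d :+ b :* c) :* (a :* d :+ b :* c)
      := (a :* a :+ b :* b) :* (c :* c :+ d :* d)) refl a b c d

  ∣^∣²≡1 : ∀ {z} → ∣ z ∣² ≡ 1ᴿ → ∀ r → ∣ z ^ r ∣² ≡ 1ᴿ
  ∣^∣²≡1 _     zero    = solve 0 (:1 :* :1 :+ :0 :* :0 := :1) refl
  ∣^∣²≡1 {z} ∣z∣²≡1 (suc r) = begin
    ∣ z ^ r ⊗ z ∣²          ≡⟨ ∣⊗∣² (z ^ r) z ⟩
    ∣ z ^ r ∣² *ᴿ ∣ z ∣²     ≡⟨ cong₂ _*ᴿ_ (∣^∣²≡1 ∣z∣²≡1 r) ∣z∣²≡1 ⟩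
    1ᴿ *ᴿ 1ᴿ                ≡⟨ *-identityˡ 1ᴿ ⟩
    1ᴿ                      ∎

  ∣negate∣² : ∀ z → ∣ negate z ∣² ≡ ∣ z ∣²
  ∣negate∣² (a , b) = solve 2 (λ a b → :- a :* :- a :+ :- b :* :- b := a :* a :+ b :* b) refl a b

  negate-⊗-negate : ∀ z → negate z ⊗ negate z ≡ z ⊗ z
  negate-⊗-negate (a , b) = cong₂ _,_
    (solve 2 (λ a b → :- a :* :- a :- :- b :* :- b := a :* a :- b :* b) refl a b)
    (solve 2 (λ a b → :- a :* :- b :+ :- b :* :- a := a :* b :+ b :* a) refl a b)

  dot-⊗ : ∀ g z → dot g (g ⊗ z) ≡ ∣ g ∣² *ᴿ re z
  dot-⊗ (a , b) (c , d) = solve 4 (λ a b c d →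
    a :* (a :* c :- b :* d) :+ b :* (a :* d :+ b :* c) := (a :* a :+ b :* b) :* c) refl a b c d

  cross-⊗ : ∀ g z → cross g (g ⊗ z) ≡ ∣ g ∣² *ᴿ im z
  cross-⊗ (a , b) (c , d) = solve 4 (λ a b c d →
    a :* (a :* d :+ b :* c) :- b :* (a :* c :- b :* d) := (a :* a :+ b :* b) :* d) refl a b c d

  ⊕-⊖-cancel : ∀ x y → (x ⊕ y) ⊖ x ≡ y
  ⊕-⊖-cancel (a , b) (c , d) = cong₂ _,_
    (solve 2 (λ a c → (a :+ c) :- a := c) refl a c) (solve 2 (λ b d → (b :+ d) :- b := d) refl b d)

  -- The quotient f / g, computed with l = 1 / ∣ g ∣².
  ratio : Point → Point → Carrier → Point
  ratio g f l = (dot g f *ᴿ l , cross g f *ᴿ l)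

  ⊗-ratio : ∀ g f l → ∣ g ∣² *ᴿ l ≡ 1ᴿ → g ⊗ ratio g f l ≡ f
  ⊗-ratio (a , b) (c , d) l ∣g∣²l≡1 = cong₂ _,_
    (trans (solve 5 (λ a b c d l → a :* ((a :* c :+ b :* d) :* l) :- b :* ((a :* d :- b :* c) :* l)
                                := c :* ((a :* a :+ b :* b) :* l)) refl a b c d l) (scale c))
    (trans (solve 5 (λ a b c d l → a :* ((a :* d :- b :* c) :* l) :+ b :* ((a :* c :+ b :* d) :* l)
                                := d :* ((a :* a :+ b :* b) :* l)) refl a b c d l) (scale d))
    where
    scale : ∀ x → x *ᴿ (∣ (a , b) ∣² *ᴿ l) ≡ x
    scale x = trans (cong (x *ᴿ_) ∣g∣²l≡1) (*-identityʳ x)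

  -- Lagrange's identity ⟨g,f⟩² + (g × f)² = ∣g∣² ∣f∣².
  ∣ratio∣² : ∀ g f l → ∣ ratio g f l ∣² ≡ (∣ g ∣² *ᴿ ∣ f ∣²) *ᴿ (l *ᴿ l)
  ∣ratio∣² (a , b) (c , d) l = solve 5 (λ a b c d l →
      ((a :* c :+ b :* d) :* l) :* ((a :* c :+ b :* d) :* l) :+ ((a :* d :- b :* c) :* l) :* ((a :* d :- b :* c) :* l)
      := ((a :* a :+ b :* b) :* (c :* c :+ d :* d)) :* (l :* l)) refl a b c d l

module PowerSums (R : RealField) where
  open ComplexPlane R public
  open ≡-Reasoning

  rePartialSum : Point → ℕ → Carrier
  rePartialSum z zero    = 0ᴿ
  rePartialSum z (suc q) = rePartialSum z q +ᴿ re (z ^ suc q)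

  re-powerSum : ∀ z q → re (powerSum z (suc q)) ≡ 1ᴿ +ᴿ rePartialSum z q
  re-powerSum z zero    = trans (+-identityˡ 1ᴿ) (sym (+-identityʳ 1ᴿ))
  re-powerSum z (suc q) = trans (cong (_+ᴿ re (z ^ suc q)) (re-powerSum z q)) (+-assoc _ _ _)

  dot-powerSum : ∀ {z} → ∣ z ∣² ≡ 1ᴿ → ∀ p d →
                 dot (powerSum z p) (z ^ (p + d)) ≡ rePartialSum z (p + d) -ᴿ rePartialSum z d
  dot-powerSum {z} _ zero d =
    solve 3 (λ x y s → :0 :* x :+ :0 :* y := s :- s) refl (re (z ^ d)) (im (z ^ d)) (rePartialSum z d)
  dot-powerSum {z} ∣z∣²≡1 (suc p) d = begin
    dot (S ⊕ z ^ p) (z ^ (suc p + d))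
      ≡⟨ cong (λ e → dot (S ⊕ z ^ p) (z ^ e)) (sym (ℕ.+-suc p d)) ⟩
    dot (S ⊕ z ^ p) (z ^ (p + suc d))
      ≡⟨ dot-⊕ˡ S (z ^ p) (z ^ (p + suc d)) ⟩
    dot S (z ^ (p + suc d)) +ᴿ dot (z ^ p) (z ^ (p + suc d))
      ≡⟨ cong₂ _+ᴿ_ (dot-powerSum ∣z∣²≡1 p (suc d)) dot-last ⟩
    (rePartialSum z (p + suc d) -ᴿ (rePartialSum z d +ᴿ c)) +ᴿ c
      ≡⟨ solve 3 (λ a b c → (a :- (b :+ c)) :+ c := a :- b) refl (rePartialSum z (p + suc d)) (rePartialSum z d) c ⟩
    rePartialSum z (p + suc d) -ᴿ rePartialSum z d
      ≡⟨ cong (λ e → rePartialSum z e -ᴿ rePartialSum z d) (ℕ.+-suc p d) ⟩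
    rePartialSum z (suc p + d) -ᴿ rePartialSum z d ∎
    where
    S : Point
    S = powerSum z p
    c : Carrier
    c = re (z ^ suc d)
    dot-⊕ˡ : ∀ x y w → dot (x ⊕ y) w ≡ dot x w +ᴿ dot y w
    dot-⊕ˡ (a , b) (c , d) (e , f) = solve 6 (λ a b c d e f →
      (a :+ c) :* e :+ (b :+ d) :* f := (a :* e :+ b :* f) :+ (c :* e :+ d :* f)) refl a b c d e f
    dot-last : dot (z ^ p) (z ^ (p + suc d)) ≡ c
    dot-last = begin
      dot (z ^ p) (z ^ (p + suc d))     ≡⟨ cong (dot (z ^ p)) (^-homo-⊗ z p (suc d)) ⟩
      dot (z ^ p) (z ^ p ⊗ z ^ suc d)   ≡⟨ dot-⊗ (z ^ p) (z ^ suc d) ⟩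
      ∣ z ^ p ∣² *ᴿ c                   ≡⟨ cong (_*ᴿ c) (∣^∣²≡1 ∣z∣²≡1 p) ⟩
      1ᴿ *ᴿ c                           ≡⟨ *-identityˡ c ⟩
      c                                 ∎

  dot-powerSum-^ : ∀ {z} → ∣ z ∣² ≡ 1ᴿ → ∀ p → dot (powerSum z p) (z ^ p) ≡ rePartialSum z p
  dot-powerSum-^ {z} ∣z∣²≡1 p = begin
    dot (powerSum z p) (z ^ p)
      ≡⟨ subst (λ e → dot (powerSum z p) (z ^ e) ≡ rePartialSum z e -ᴿ 0ᴿ) (ℕ.+-identityʳ p) (dot-powerSum ∣z∣²≡1 p 0) ⟩
    rePartialSum z p -ᴿ 0ᴿ
      ≡⟨ solve 1 (λ a → a :- :0 := a) refl (rePartialSum z p) ⟩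
    rePartialSum z p ∎

  -- For v = e^{iθ} these are the identities
  --   sin θ · (sin 0 + sin 2θ + ⋯ + sin 2jθ) = sin (j+1)θ · sin jθ,
  --   (cos 2θ + ⋯ + cos 2qθ) · sin θ = cos (q+1)θ · sin qθ.
  module SquareRoot (v : Point) (∣v∣²≡1 : ∣ v ∣² ≡ 1ᴿ) where
    ζ : Point
    ζ = v ⊗ v

    *∣v∣² : ∀ u → u *ᴿ ∣ v ∣² ≡ u
    *∣v∣² u = trans (cong (u *ᴿ_) ∣v∣²≡1) (*-identityʳ u)

    im-powerSum : ∀ j → im v *ᴿ im (powerSum ζ (suc j)) ≡ im (v ^ suc j) *ᴿ im (v ^ j)
    im-powerSum zero = solve 2 (λ x y → y :* (:0 :+ :0) := (:1 :* y :+ :0 :* x) :* :0) refl (re v) (im v)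
    im-powerSum (suc j) = begin
      im v *ᴿ (im (powerSum ζ (suc j)) +ᴿ im (ζ ^ suc j))
        ≡⟨ distribˡ _ _ _ ⟩
      im v *ᴿ im (powerSum ζ (suc j)) +ᴿ im v *ᴿ im (ζ ^ suc j)
        ≡⟨ cong₂ _+ᴿ_ (im-powerSum j) (cong (λ u → im v *ᴿ im u) (^-distrib-⊗ v v (suc j))) ⟩
      im a *ᴿ im b +ᴿ im v *ᴿ im (a ⊗ a)
        ≡⟨ cong (im a *ᴿ im b +ᴿ_) (sym step) ⟩
      im a *ᴿ im b +ᴿ im a *ᴿ (im (a ⊗ v) -ᴿ im b)
        ≡⟨ solve 3 (λ p q r → p :* q :+ p :* (r :- q) := r :* p) refl (im a) (im b) (im (a ⊗ v)) ⟩
      im (a ⊗ v) *ᴿ im a ∎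
      where
      b a : Point
      b = v ^ j
      a = b ⊗ v
      step : im a *ᴿ (im (a ⊗ v) -ᴿ im b) ≡ im v *ᴿ im (a ⊗ a)
      step = trans (cong (λ u → im a *ᴿ (im (a ⊗ v) -ᴿ u)) (sym (*∣v∣² (im b)))) (identity b v)
        where
        identity : ∀ b v → im (b ⊗ v) *ᴿ (im (b ⊗ v ⊗ v) -ᴿ im b *ᴿ ∣ v ∣²)
                           ≡ im v *ᴿ im ((b ⊗ v) ⊗ (b ⊗ v))
        identity (p , q) (x , y) = solve 4 (λ p q x y →
          let a₁ = p :* x :- q :* y ; a₂ = p :* y :+ q :* x in
          a₂ :* ((a₁ :* y :+ a₂ :* x) :- q :* (x :* x :+ y :* y)) := y :* (a₁ :* a₂ :+ a₂ :* a₁)) refl p q x y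

    rePartialSum-im : ∀ q → rePartialSum ζ q *ᴿ im v ≡ re (v ^ suc q) *ᴿ im (v ^ q)
    rePartialSum-im zero = solve 2 (λ x y → :0 :* y := (:1 :* x :- :0 :* y) :* :0) refl (re v) (im v)
    rePartialSum-im (suc q) = begin
      (rePartialSum ζ q +ᴿ re (ζ ^ suc q)) *ᴿ im v
        ≡⟨ distribʳ _ _ _ ⟩
      rePartialSum ζ q *ᴿ im v +ᴿ re (ζ ^ suc q) *ᴿ im v
        ≡⟨ cong₂ _+ᴿ_ (rePartialSum-im q) (cong (λ u → re u *ᴿ im v) (^-distrib-⊗ v v (suc q))) ⟩
      re a *ᴿ im b +ᴿ re (a ⊗ a) *ᴿ im v
        ≡⟨ cong (re a *ᴿ im b +ᴿ_) (sym step) ⟩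
      re a *ᴿ im b +ᴿ (re (a ⊗ v) *ᴿ im a -ᴿ re a *ᴿ im b)
        ≡⟨ solve 2 (λ p r → p :+ (r :- p) := r) refl (re a *ᴿ im b) (re (a ⊗ v) *ᴿ im a) ⟩
      re (a ⊗ v) *ᴿ im a ∎
      where
      b a : Point
      b = v ^ q
      a = b ⊗ v
      step : re (a ⊗ v) *ᴿ im a -ᴿ re a *ᴿ im b ≡ re (a ⊗ a) *ᴿ im v
      step = trans (cong (λ u → re (a ⊗ v) *ᴿ im a -ᴿ re a *ᴿ u) (sym (*∣v∣² (im b)))) (identity b v)
        where
        identity : ∀ b v → re (b ⊗ v ⊗ v) *ᴿ im (b ⊗ v) -ᴿ re (b ⊗ v) *ᴿ (im b *ᴿ ∣ v ∣²)
                           ≡ re ((b ⊗ v) ⊗ (b ⊗ v)) *ᴿ im v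
        identity (p , q) (x , y) = solve 4 (λ p q x y →
          let a₁ = p :* x :- q :* y ; a₂ = p :* y :+ q :* x in
          (a₁ :* x :- a₂ :* y) :* a₂ :- a₁ :* (q :* (x :* x :+ y :* y)) := (a₁ :* a₁ :- a₂ :* a₂) :* y) refl p q x y

    0<rePartialSum : ∀ k → 0ᴿ <ᴿ im v →
                     (∀ r → 2 ≤ r → r ≤ k + k → 0ᴿ <ᴿ im (powerSum ζ r)) →
                     ∀ q → 1 ≤ q → suc q ≤ k → 0ᴿ <ᴿ rePartialSum ζ q
    0<rePartialSum k 0<im-v 0<im-powerSum q 1≤q q<k =
      *-cancelˡ-pos 0<im-v (subst (0ᴿ <ᴿ_) (trans (sym (rePartialSum-im q)) (*-comm _ _))
        (*-pos (0<re-^ (suc q) (s≤s z≤n) q<k) (0<im-^ q 1≤q (ℕ.≤-trans (ℕ.n≤1+n q) (≤k+k q<k)))))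
      where
      ≤k+k : ∀ {j} → j ≤ k → j ≤ k + k
      ≤k+k j≤k = ℕ.≤-trans j≤k (ℕ.m≤m+n k k)

      0<im-^ : ∀ j → 1 ≤ j → j ≤ k + k → 0ᴿ <ᴿ im (v ^ j)
      0<im-^ 1 _ _ = subst (0ᴿ <ᴿ_) (solve 2 (λ x y → y := :1 :* y :+ :0 :* x) refl (re v) (im v)) 0<im-v
      0<im-^ (suc (suc j)) _ j+2≤2k =
        *-cancelˡ-pos (0<im-^ (suc j) (s≤s z≤n) (ℕ.≤-trans (ℕ.n≤1+n _) j+2≤2k))
          (subst (0ᴿ <ᴿ_) (trans (im-powerSum (suc j)) (*-comm _ _))
            (*-pos 0<im-v (0<im-powerSum (suc (suc j)) (s≤s (s≤s z≤n)) j+2≤2k)))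

      0<re-^ : ∀ m → 1 ≤ m → m ≤ k → 0ᴿ <ᴿ re (v ^ m)
      0<re-^ m 1≤m m≤k =
        *-cancelˡ-pos (+-pos 0<1 0<1) (*-cancelˡ-pos (0<im-^ m 1≤m (≤k+k m≤k))
          (subst (0ᴿ <ᴿ_) double-angle (0<im-^ (m + m) (ℕ.≤-trans 1≤m (ℕ.m≤m+n m m)) (ℕ.+-mono-≤ m≤k m≤k))))
        where
        double-angle : im (v ^ (m + m)) ≡ im (v ^ m) *ᴿ ((1ᴿ +ᴿ 1ᴿ) *ᴿ re (v ^ m))
        double-angle = trans (cong im (^-homo-⊗ v m m))
          (solve 2 (λ c s → c :* s :+ s :* c := s :* ((:1 :+ :1) :* c)) refl (re (v ^ m)) (im (v ^ m)))

module CyclicShift (m : ℕ) where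
  open ≡-Reasoning

  next^ : ℕ → Fin (suc m) → Fin (suc m)
  next^ zero    i = i
  next^ (suc r) i = next (next^ r i)

  private
    n : ℕ
    n = suc m

    [m+n%d]%d≡[m+n]%d : ∀ a b → (a + b % n) % n ≡ (a + b) % n
    [m+n%d]%d≡[m+n]%d a b = begin
      (a + b % n) % n              ≡⟨ %-distribˡ-+ a (b % n) n ⟩
      (a % n + b % n % n) % n      ≡⟨ cong (λ u → (a % n + u) % n) (m%n%n≡m%n b n) ⟩
      (a % n + b % n) % n          ≡⟨ sym (%-distribˡ-+ a b n) ⟩
      (a + b) % n                  ∎

  toℕ-next^ : ∀ r i → toℕ (next^ r i) ≡ (toℕ i + r) % n
  toℕ-next^ zero i = sym (trans (cong (_% n) (ℕ.+-identityʳ (toℕ i))) (m<n⇒m%n≡m (Fin.toℕ<n i)))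
  toℕ-next^ (suc r) i = begin
    toℕ (next (next^ r i))         ≡⟨ Fin.toℕ-fromℕ< (m%n<n (suc (toℕ (next^ r i))) n) ⟩
    suc (toℕ (next^ r i)) % n      ≡⟨ cong (λ u → suc u % n) (toℕ-next^ r i) ⟩
    (1 + (toℕ i + r) % n) % n      ≡⟨ [m+n%d]%d≡[m+n]%d 1 (toℕ i + r) ⟩
    suc (toℕ i + r) % n            ≡⟨ cong (_% n) (sym (ℕ.+-suc (toℕ i) r)) ⟩
    (toℕ i + suc r) % n            ∎

  toℕ-next^-zero : ∀ {r} → r < n → toℕ (next^ r Fin.zero) ≡ r
  toℕ-next^-zero {r} r<n = trans (toℕ-next^ r Fin.zero) (m<n⇒m%n≡m r<n)

  next^-+ : ∀ a b i → next^ (a + b) i ≡ next^ a (next^ b i)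
  next^-+ zero    b i = refl
  next^-+ (suc a) b i = cong next (next^-+ a b i)

  next^-period : ∀ i → next^ n i ≡ i
  next^-period i = Fin.toℕ-injective (begin
    toℕ (next^ n i)     ≡⟨ toℕ-next^ n i ⟩
    (toℕ i + n) % n     ≡⟨ [m+n]%n≡m%n (toℕ i) n ⟩
    toℕ i % n           ≡⟨ m<n⇒m%n≡m (Fin.toℕ<n i) ⟩
    toℕ i               ∎)

  next^-surjective : ∀ i j → ∃ λ r → r < n × next^ r i ≡ j
  next^-surjective i j = r , m%n<n (toℕ j + (n ∸ toℕ i)) n , Fin.toℕ-injective (begin
    toℕ (next^ r i)                           ≡⟨ toℕ-next^ r i ⟩
    (toℕ i + r) % n                           ≡⟨ [m+n%d]%d≡[m+n]%d (toℕ i) _ ⟩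
    (toℕ i + (toℕ j + (n ∸ toℕ i))) % n       ≡⟨ cong (_% n) (ℕ.+-comm (toℕ i) _) ⟩
    ((toℕ j + (n ∸ toℕ i)) + toℕ i) % n       ≡⟨ cong (_% n) (ℕ.+-assoc (toℕ j) _ (toℕ i)) ⟩
    (toℕ j + ((n ∸ toℕ i) + toℕ i)) % n       ≡⟨ cong (λ u → (toℕ j + u) % n) (ℕ.m∸n+n≡m (ℕ.<⇒≤ (Fin.toℕ<n i))) ⟩
    (toℕ j + n) % n                           ≡⟨ [m+n]%n≡m%n (toℕ j) n ⟩
    toℕ j % n                                 ≡⟨ m<n⇒m%n≡m (Fin.toℕ<n j) ⟩
    toℕ j                                     ∎)
    where
    r : ℕ
    r = (toℕ j + (n ∸ toℕ i)) % n

  next^-fixed⇒multiple : ∀ r i → next^ r i ≡ i → ∃ λ q → r ≡ q * n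
  next^-fixed⇒multiple r i fixed = (toℕ i + r) / n , ℕ.+-cancelˡ-≡ (toℕ i) _ _ (begin
    toℕ i + r                                  ≡⟨ m≡m%n+[m/n]*n (toℕ i + r) n ⟩
    (toℕ i + r) % n + ((toℕ i + r) / n) * n
      ≡⟨ cong (_+ ((toℕ i + r) / n) * n) (trans (sym (toℕ-next^ r i)) (cong toℕ fixed)) ⟩
    toℕ i + ((toℕ i + r) / n) * n              ∎)

module RegularPolygonGeometry (R : RealField) {m : ℕ} (Q : Geometry.RegularPolygon R m) where
  open PowerSums R public
  open Geometry.RegularPolygon Q public
  open CyclicShift m public
  open ≡-Reasoning

  private
    i₀ : Fin (suc m)
    i₀ = Fin.zero

    L : Carrier
    L = ∣ edge i₀ ∣²

    0<L : 0ᴿ <ᴿ L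
    0<L = edge-pos i₀

    ℓ : Carrier
    ℓ = proj₁ (inverse L (pos⇒≢0 0<L))

    Lℓ≡1 : L *ᴿ ℓ ≡ 1ᴿ
    Lℓ≡1 = proj₂ (inverse L (pos⇒≢0 0<L))

    ∣edge∣²≢0 : ∀ i → ∣ edge i ∣² ≢ 0ᴿ
    ∣edge∣²≢0 i = pos⇒≢0 (edge-pos i)

  ζ : Point
  ζ = ratio (edge i₀) (edge (next i₀)) ℓ

  edge-next : ∀ i → edge (next i) ≡ edge i ⊗ ζ
  edge-next i = sym (begin
    edge i ⊗ ζ
      ≡⟨ cong₂ (λ d c → edge i ⊗ (d *ᴿ ℓ , c *ᴿ ℓ)) (equal-dot i₀ i) (equal-cross i₀ i) ⟩
    edge i ⊗ ratio (edge i) (edge (next i)) ℓ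
      ≡⟨ ⊗-ratio (edge i) (edge (next i)) ℓ (trans (cong (_*ᴿ ℓ) (equal-side i i₀)) Lℓ≡1) ⟩
    edge (next i) ∎)

  ∣ζ∣²≡1 : ∣ ζ ∣² ≡ 1ᴿ
  ∣ζ∣²≡1 = begin
    ∣ ζ ∣²                                  ≡⟨ ∣ratio∣² (edge i₀) (edge (next i₀)) ℓ ⟩
    (L *ᴿ ∣ edge (next i₀) ∣²) *ᴿ (ℓ *ᴿ ℓ)  ≡⟨ cong (λ u → (L *ᴿ u) *ᴿ (ℓ *ᴿ ℓ)) (equal-side (next i₀) i₀) ⟩
    (L *ᴿ L) *ᴿ (ℓ *ᴿ ℓ)                    ≡⟨ solve 2 (λ a l → (a :* a) :* (l :* l) := (a :* l) :* (a :* l)) refl L ℓ ⟩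
    (L *ᴿ ℓ) *ᴿ (L *ᴿ ℓ)                    ≡⟨ cong₂ _*ᴿ_ Lℓ≡1 Lℓ≡1 ⟩
    1ᴿ *ᴿ 1ᴿ                                ≡⟨ *-identityˡ 1ᴿ ⟩
    1ᴿ                                      ∎

  edge-next^ : ∀ r i → edge (next^ r i) ≡ edge i ⊗ ζ ^ r
  edge-next^ zero    i = sym (⊗-identityʳ (edge i))
  edge-next^ (suc r) i = begin
    edge (next (next^ r i))      ≡⟨ edge-next (next^ r i) ⟩
    edge (next^ r i) ⊗ ζ         ≡⟨ cong (_⊗ ζ) (edge-next^ r i) ⟩
    edge i ⊗ ζ ^ r ⊗ ζ           ≡⟨ ⊗-assoc (edge i) (ζ ^ r) ζ ⟩
    edge i ⊗ ζ ^ suc r           ∎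

  vertex-next : ∀ i → V (next i) ≡ V i ⊕ edge i
  vertex-next i =
    cong₂ _,_ (x≡y+[x-y] (proj₁ (V (next i))) (proj₁ (V i))) (x≡y+[x-y] (proj₂ (V (next i))) (proj₂ (V i)))
    where
    x≡y+[x-y] : ∀ x y → x ≡ y +ᴿ (x -ᴿ y)
    x≡y+[x-y] = solve 2 (λ x y → x := y :+ (x :- y)) refl

  vertex-next^ : ∀ r i → V (next^ r i) ≡ V i ⊕ edge i ⊗ powerSum ζ r
  vertex-next^ zero    i = sym (⊕-⊗-zero (V i) (edge i))
    where
    ⊕-⊗-zero : ∀ x g → x ⊕ g ⊗ (0ᴿ , 0ᴿ) ≡ x
    ⊕-⊗-zero (x , y) (a , b) = cong₂ _,_
      (solve 3 (λ x a b → x :+ (a :* :0 :- b :* :0) := x) refl x a b)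
      (solve 3 (λ y a b → y :+ (a :* :0 :+ b :* :0) := y) refl y a b)
  vertex-next^ (suc r) i = begin
    V (next (next^ r i))                          ≡⟨ vertex-next (next^ r i) ⟩
    V (next^ r i) ⊕ edge (next^ r i)              ≡⟨ cong₂ _⊕_ (vertex-next^ r i) (edge-next^ r i) ⟩
    V i ⊕ edge i ⊗ powerSum ζ r ⊕ edge i ⊗ ζ ^ r  ≡⟨ ⊕-⊗-distrib (V i) (edge i) (powerSum ζ r) (ζ ^ r) ⟩
    V i ⊕ edge i ⊗ powerSum ζ (suc r)             ∎
    where
    ⊕-⊗-distrib : ∀ x g y z → x ⊕ g ⊗ y ⊕ g ⊗ z ≡ x ⊕ g ⊗ (y ⊕ z)
    ⊕-⊗-distrib (x₁ , x₂) (a , b) (c , d) (e , f) = cong₂ _,_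
      (solve 7 (λ x a b c d e f → (x :+ (a :* c :- b :* d)) :+ (a :* e :- b :* f)
                               := x :+ (a :* (c :+ e) :- b :* (d :+ f))) refl x₁ a b c d e f)
      (solve 7 (λ x a b c d e f → (x :+ (a :* d :+ b :* c)) :+ (a :* f :+ b :* e)
                               := x :+ (a :* (d :+ f) :+ b :* (c :+ e))) refl x₂ a b c d e f)

  ζ^n≡1 : ζ ^ suc m ≡ 1ℂ
  ζ^n≡1 = cong₂ _,_ (x-y≡0⇒x≡y (*-cancelˡ-≡0 (∣edge∣²≢0 i₀) re-eq)) (*-cancelˡ-≡0 (∣edge∣²≢0 i₀) im-eq)
    where
    g z : Point
    g = edge i₀
    z = ζ ^ suc m
    g≡g⊗z : g ≡ g ⊗ z
    g≡g⊗z = trans (cong edge (sym (next^-period i₀))) (edge-next^ (suc m) i₀)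
    re-eq : L *ᴿ (re z -ᴿ 1ᴿ) ≡ 0ᴿ
    re-eq = begin
      L *ᴿ (re z -ᴿ 1ᴿ)   ≡⟨ solve 2 (λ l a → l :* (a :- :1) := l :* a :- l) refl L (re z) ⟩
      L *ᴿ re z -ᴿ L      ≡⟨ cong (_-ᴿ L) (trans (sym (dot-⊗ g z)) (cong (dot g) (sym g≡g⊗z))) ⟩
      L -ᴿ L              ≡⟨ -‿inverseʳ L ⟩
      0ᴿ                  ∎
    im-eq : L *ᴿ im z ≡ 0ᴿ
    im-eq = begin
      L *ᴿ im z           ≡⟨ trans (sym (cross-⊗ g z)) (cong (cross g) (sym g≡g⊗z)) ⟩
      cross g g           ≡⟨ solve 2 (λ a b → a :* b :- b :* a := :0) refl (proj₁ g) (proj₂ g) ⟩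
      0ᴿ                  ∎

  -- Convexity: the vertex r steps after vertex 0 lies strictly left of side 0.
  0<im-powerSum : ∀ r → 2 ≤ r → r ≤ m → 0ᴿ <ᴿ im (powerSum ζ r)
  0<im-powerSum r 2≤r r≤m = *-cancelˡ-pos 0<L (subst (0ᴿ <ᴿ_) cross≡ (convex-ccw i₀ j j≢0 j≢1))
    where
    j : Fin (suc m)
    j = next^ r i₀
    toℕ-j : toℕ j ≡ r
    toℕ-j = toℕ-next^-zero (s≤s r≤m)
    j≢0 : j ≢ i₀
    j≢0 j≡0 = ℕ.<⇒≢ (ℕ.≤-trans (s≤s z≤n) 2≤r) (trans (cong toℕ (sym j≡0)) toℕ-j)
    j≢1 : j ≢ next i₀
    j≢1 j≡1 = ℕ.<⇒≢ 2≤r (trans (sym (toℕ-next^-zero 1<n)) (trans (cong toℕ (sym j≡1)) toℕ-j))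
      where
      1<n : 1 < suc m
      1<n = s≤s (ℕ.≤-trans (ℕ.≤-trans (ℕ.n≤1+n 1) 2≤r) r≤m)
    cross≡ : cross (edge i₀) (V j ⊖ V i₀) ≡ L *ᴿ im (powerSum ζ r)
    cross≡ = begin
      cross (edge i₀) (V j ⊖ V i₀)
        ≡⟨ cong (λ x → cross (edge i₀) (x ⊖ V i₀)) (vertex-next^ r i₀) ⟩
      cross (edge i₀) ((V i₀ ⊕ edge i₀ ⊗ powerSum ζ r) ⊖ V i₀)
        ≡⟨ cong (cross (edge i₀)) (⊕-⊖-cancel (V i₀) _) ⟩
      cross (edge i₀) (edge i₀ ⊗ powerSum ζ r)
        ≡⟨ cross-⊗ (edge i₀) (powerSum ζ r) ⟩
      L *ᴿ im (powerSum ζ r) ∎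

  along : Point → Point → Carrier → Point
  along (x , y) (a , b) l = (x +ᴿ l *ᴿ a , y +ᴿ l *ᴿ b)

  pointOn : Fin (suc m) → Carrier → Point
  pointOn i = along (V i) (edge i)

  pointOn-0 : ∀ i → pointOn i 0ᴿ ≡ V i
  pointOn-0 i = cong₂ _,_ (x+0*a≡x (proj₁ (V i)) (proj₁ (edge i))) (x+0*a≡x (proj₂ (V i)) (proj₂ (edge i)))
    where
    x+0*a≡x : ∀ x a → x +ᴿ 0ᴿ *ᴿ a ≡ x
    x+0*a≡x = solve 2 (λ x a → x :+ :0 :* a := x) refl

  pointOn-1 : ∀ i → pointOn i 1ᴿ ≡ V (next i)
  pointOn-1 i = trans
    (cong₂ _,_ (x+1*a≡x+a (proj₁ (V i)) (proj₁ (edge i))) (x+1*a≡x+a (proj₂ (V i)) (proj₂ (edge i))))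
    (sym (vertex-next i))
    where
    x+1*a≡x+a : ∀ x a → x +ᴿ 1ᴿ *ᴿ a ≡ x +ᴿ a
    x+1*a≡x+a = solve 2 (λ x a → x :+ :1 :* a := x :+ a) refl

  pointOn-next^ : ∀ r i l → pointOn (next^ r i) l ≡ along (V i ⊕ edge i ⊗ powerSum ζ r) (edge i ⊗ ζ ^ r) l
  pointOn-next^ r i l = cong₂ (λ x g → along x g l) (vertex-next^ r i) (edge-next^ r i)

  -- l' is the parameter along side i of the foot of the perpendicular from pointOn (next^ r i) l.
  perpendicular-forward : ∀ r i l l' → dot (pointOn (next^ r i) l ⊖ pointOn i l') (edge i) ≡ 0ᴿ →
                          (re (powerSum ζ r) +ᴿ l *ᴿ re (ζ ^ r)) -ᴿ l' ≡ 0ᴿ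
  perpendicular-forward r i l l' perp = *-cancelˡ-≡0 (∣edge∣²≢0 i) (begin
    ∣ edge i ∣² *ᴿ ((re (powerSum ζ r) +ᴿ l *ᴿ re (ζ ^ r)) -ᴿ l')
      ≡⟨ sym (chord-dot (V i) (edge i) (powerSum ζ r) (ζ ^ r) l l') ⟩
    dot (along (V i ⊕ edge i ⊗ powerSum ζ r) (edge i ⊗ ζ ^ r) l ⊖ pointOn i l') (edge i)
      ≡⟨ cong (λ p → dot (p ⊖ pointOn i l') (edge i)) (sym (pointOn-next^ r i l)) ⟩
    dot (pointOn (next^ r i) l ⊖ pointOn i l') (edge i)
      ≡⟨ perp ⟩
    0ᴿ ∎)
    where
    chord-dot : ∀ x g S W l l' → dot (along (x ⊕ g ⊗ S) (g ⊗ W) l ⊖ along x g l') g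
                                 ≡ ∣ g ∣² *ᴿ ((re S +ᴿ l *ᴿ re W) -ᴿ l')
    chord-dot (x₁ , x₂) (g₁ , g₂) (s₁ , s₂) (w₁ , w₂) l l' = solve 10 (λ x₁ x₂ g₁ g₂ s₁ s₂ w₁ w₂ l l' →
        ((x₁ :+ (g₁ :* s₁ :- g₂ :* s₂)) :+ l :* (g₁ :* w₁ :- g₂ :* w₂) :- (x₁ :+ l' :* g₁)) :* g₁ :+
        ((x₂ :+ (g₁ :* s₂ :+ g₂ :* s₁)) :+ l :* (g₁ :* w₂ :+ g₂ :* w₁) :- (x₂ :+ l' :* g₂)) :* g₂
        := (g₁ :* g₁ :+ g₂ :* g₂) :* ((s₁ :+ l :* w₁) :- l')) refl x₁ x₂ g₁ g₂ s₁ s₂ w₁ w₂ l l'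

  -- Likewise l' for the foot on side next^ p i of the perpendicular from pointOn i l.
  perpendicular-backward : ∀ p i l l' → dot (pointOn i l ⊖ pointOn (next^ p i) l') (edge (next^ p i)) ≡ 0ᴿ →
                           (l *ᴿ re (ζ ^ p) -ᴿ rePartialSum ζ p) -ᴿ l' ≡ 0ᴿ
  perpendicular-backward p i l l' perp = *-cancelˡ-≡0 (∣edge∣²≢0 i) (begin
    ∣ edge i ∣² *ᴿ ((l *ᴿ re W -ᴿ rePartialSum ζ p) -ᴿ l')
      ≡⟨ cong₂ (λ d u → ∣ edge i ∣² *ᴿ ((l *ᴿ re W -ᴿ d) -ᴿ u)) (sym (dot-powerSum-^ ∣ζ∣²≡1 p))
                                                              (sym (trans (cong (l' *ᴿ_) (∣^∣²≡1 ∣ζ∣²≡1 p)) (*-identityʳ l'))) ⟩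
    ∣ edge i ∣² *ᴿ ((l *ᴿ re W -ᴿ dot S W) -ᴿ l' *ᴿ ∣ W ∣²)
      ≡⟨ sym (chord-dot (V i) (edge i) S W l l') ⟩
    dot (pointOn i l ⊖ along (V i ⊕ edge i ⊗ S) (edge i ⊗ W) l') (edge i ⊗ W)
      ≡⟨ cong₂ (λ q g → dot (pointOn i l ⊖ q) g) (sym (pointOn-next^ p i l')) (sym (edge-next^ p i)) ⟩
    dot (pointOn i l ⊖ pointOn (next^ p i) l') (edge (next^ p i))
      ≡⟨ perp ⟩
    0ᴿ ∎)
    where
    S W : Point
    S = powerSum ζ p
    W = ζ ^ p
    chord-dot : ∀ x g S W l l' → dot (along x g l ⊖ along (x ⊕ g ⊗ S) (g ⊗ W) l') (g ⊗ W)
                                 ≡ ∣ g ∣² *ᴿ ((l *ᴿ re W -ᴿ dot S W) -ᴿ l' *ᴿ ∣ W ∣²)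
    chord-dot (x₁ , x₂) (g₁ , g₂) (s₁ , s₂) (w₁ , w₂) l l' = solve 10 (λ x₁ x₂ g₁ g₂ s₁ s₂ w₁ w₂ l l' →
        ((x₁ :+ l :* g₁) :- ((x₁ :+ (g₁ :* s₁ :- g₂ :* s₂)) :+ l' :* (g₁ :* w₁ :- g₂ :* w₂))) :* (g₁ :* w₁ :- g₂ :* w₂) :+
        ((x₂ :+ l :* g₂) :- ((x₂ :+ (g₁ :* s₂ :+ g₂ :* s₁)) :+ l' :* (g₁ :* w₂ :+ g₂ :* w₁))) :* (g₁ :* w₂ :+ g₂ :* w₁)
        := (g₁ :* g₁ :+ g₂ :* g₂) :* ((l :* w₁ :- (s₁ :* w₁ :+ s₂ :* w₂)) :- l' :* (w₁ :* w₁ :+ w₂ :* w₂))) refl x₁ x₂ g₁ g₂ s₁ s₂ w₁ w₂ l l'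

module OddRegularPolygon (R : RealField) (k : ℕ) (Q : Geometry.RegularPolygon R (2 * k)) where
  open RegularPolygonGeometry R Q public
  open IsStrictTotalOrder isStrictTotalOrder using (compare)
  open ≡-Reasoning

  private
    2k≡k+k : 2 * k ≡ k + k
    2k≡k+k = cong (k +_) (ℕ.+-identityʳ k)

    u : Point
    u = ζ ^ suc k

    -- ζ ^ (2k+1) = 1, so ± ζ ^ (k+1) are the square roots of ζ.
    u⊗u≡ζ : u ⊗ u ≡ ζ
    u⊗u≡ζ = begin
      u ⊗ u                  ≡⟨ sym (^-homo-⊗ ζ (suc k) (suc k)) ⟩
      ζ ^ (suc k + suc k)    ≡⟨ cong (λ e → ζ ^ suc e) (trans (ℕ.+-suc k k) (cong suc (sym 2k≡k+k))) ⟩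
      ζ ^ suc (2 * k) ⊗ ζ    ≡⟨ cong (_⊗ ζ) ζ^n≡1 ⟩
      1ℂ ⊗ ζ                 ≡⟨ ⊗-identityˡ ζ ⟩
      ζ                      ∎

    ∣u∣²≡1 : ∣ u ∣² ≡ 1ᴿ
    ∣u∣²≡1 = ∣^∣²≡1 ∣ζ∣²≡1 (suc k)

  unit-square-root : 1 ≤ k → ∃ λ v → v ⊗ v ≡ ζ × ∣ v ∣² ≡ 1ᴿ × 0ᴿ <ᴿ im v
  unit-square-root 1≤k with compare (im u) 0ᴿ
  ... | tri< im-u<0 _ _ =
    negate u , trans (negate-⊗-negate u) u⊗u≡ζ , trans (∣negate∣² u) ∣u∣²≡1 , x<0⇒0<-x im-u<0
  ... | tri> _ _ 0<im-u = u , u⊗u≡ζ , ∣u∣²≡1 , 0<im-u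
  ... | tri≈ _ im-u≡0 _ = ⊥-elim (pos⇒≢0 0<im-ζ (begin
    im ζ                          ≡⟨ cong im (sym u⊗u≡ζ) ⟩
    re u *ᴿ im u +ᴿ im u *ᴿ re u  ≡⟨ cong (λ y → re u *ᴿ y +ᴿ y *ᴿ re u) im-u≡0 ⟩
    re u *ᴿ 0ᴿ +ᴿ 0ᴿ *ᴿ re u      ≡⟨ solve 1 (λ a → a :* :0 :+ :0 :* a := :0) refl (re u) ⟩
    0ᴿ                            ∎))
    where
    0<im-ζ : 0ᴿ <ᴿ im ζ
    0<im-ζ = subst (0ᴿ <ᴿ_) (solve 2 (λ a b → (:0 :+ :0) :+ (:1 :* b :+ :0 :* a) := b) refl (re ζ) (im ζ))
                   (0<im-powerSum 2 ℕ.≤-refl (subst (2 ≤_) (sym 2k≡k+k) (ℕ.+-mono-≤ 1≤k 1≤k)))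

  0<rePartialSum-ζ : ∀ q → 1 ≤ q → suc q ≤ k → 0ᴿ <ᴿ rePartialSum ζ q
  0<rePartialSum-ζ q 1≤q q<k with unit-square-root (ℕ.≤-trans (s≤s z≤n) q<k)
  ... | v , v⊗v≡ζ , ∣v∣²≡1 , 0<im-v = subst (λ z → 0ᴿ <ᴿ rePartialSum z q) v⊗v≡ζ
    (SquareRoot.0<rePartialSum v ∣v∣²≡1 k 0<im-v 0<im-powerSum-v⊗v q 1≤q q<k)
    where
    0<im-powerSum-v⊗v : ∀ r → 2 ≤ r → r ≤ k + k → 0ᴿ <ᴿ im (powerSum (v ⊗ v) r)
    0<im-powerSum-v⊗v r 2≤r r≤k+k = subst (λ z → 0ᴿ <ᴿ im (powerSum z r)) (sym v⊗v≡ζ)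
      (0<im-powerSum r 2≤r (subst (r ≤_) (sym 2k≡k+k) r≤k+k))

  rePartialSum-blend≡0 : ∀ q {l c} → suc (suc q) ≤ k → 0ᴿ ≤ᴿ l → 0ᴿ ≤ᴿ 1ᴿ -ᴿ l → 0ᴿ ≤ᴿ c →
    ((1ᴿ -ᴿ l) *ᴿ rePartialSum ζ q +ᴿ l *ᴿ rePartialSum ζ (suc q)) +ᴿ c ≡ 0ᴿ → q ≡ 0 × l ≡ 0ᴿ × c ≡ 0ᴿ
  rePartialSum-blend≡0 zero {l} q<k 0≤l 0≤1-l 0≤c blend≡0 = refl ,
    *-cancelˡ-≡0 (pos⇒≢0 0<S₁) (trans (solve 2 (λ s l → s :* l := (:1 :- l) :* :0 :+ l :* s) refl S₁ l)
                                       (+-nonNeg-≡0ˡ 0≤blend 0≤c blend≡0)) ,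
    +-nonNeg-≡0ʳ 0≤blend 0≤c blend≡0
    where
    S₁ : Carrier
    S₁ = rePartialSum ζ 1
    0<S₁ : 0ᴿ <ᴿ S₁
    0<S₁ = 0<rePartialSum-ζ 1 ℕ.≤-refl q<k
    0≤blend : 0ᴿ ≤ᴿ (1ᴿ -ᴿ l) *ᴿ 0ᴿ +ᴿ l *ᴿ S₁
    0≤blend = +-nonNeg (*-nonNeg 0≤1-l (inj₂ refl)) (*-nonNeg 0≤l (inj₁ 0<S₁))
  rePartialSum-blend≡0 (suc q) {l} q<k 0≤l 0≤1-l 0≤c blend≡0 =
    ⊥-elim (pos⇒≢0 (+-pos-nonNeg 0<blend 0≤c) blend≡0)
    where
    0<blend : 0ᴿ <ᴿ (1ᴿ -ᴿ l) *ᴿ rePartialSum ζ (suc q) +ᴿ l *ᴿ rePartialSum ζ (suc (suc q))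
    0<blend = convex-pos (0<rePartialSum-ζ (suc q) (s≤s z≤n) (ℕ.≤-trans (ℕ.n≤1+n _) q<k))
                         (0<rePartialSum-ζ (suc (suc q)) (s≤s z≤n) q<k) 0≤l 0≤1-l

  perpendicular-same-side : ∀ i {l l'} → dot (pointOn i l ⊖ pointOn i l') (edge i) ≡ 0ᴿ → pointOn i l ≡ pointOn i l'
  perpendicular-same-side i {l} {l'} perp = cong (pointOn i) (x-y≡0⇒x≡y (trans
    (solve 2 (λ l l' → l :- l' := (:0 :+ l :* :1) :- l') refl l l') (perpendicular-forward 0 i l l' perp)))

  perpendicular-forward-degenerate : ∀ q i {l l'} → suc (suc q) ≤ k → 0ᴿ ≤ᴿ l → l ≤ᴿ 1ᴿ → l' ≤ᴿ 1ᴿ →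
    dot (pointOn (next^ (suc q) i) l ⊖ pointOn i l') (edge i) ≡ 0ᴿ → pointOn (next^ (suc q) i) l ≡ pointOn i l'
  perpendicular-forward-degenerate q i {l} {l'} q<k 0≤l l≤1 l'≤1 perp =
    conclude (rePartialSum-blend≡0 q q<k 0≤l (x≤1⇒0≤1-x l≤1) (x≤1⇒0≤1-x l'≤1)
                                   (trans blend≡ (perpendicular-forward (suc q) i l l' perp)))
    where
    a c : Carrier
    a = rePartialSum ζ q
    c = re (ζ ^ suc q)
    blend≡ : ((1ᴿ -ᴿ l) *ᴿ a +ᴿ l *ᴿ (a +ᴿ c)) +ᴿ (1ᴿ -ᴿ l') ≡ (re (powerSum ζ (suc q)) +ᴿ l *ᴿ c) -ᴿ l'
    blend≡ = trans
      (solve 4 (λ a c l l' → ((:1 :- l) :* a :+ l :* (a :+ c)) :+ (:1 :- l') := ((:1 :+ a) :+ l :* c) :- l')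
               refl a c l l')
      (cong (λ x → (x +ᴿ l *ᴿ c) -ᴿ l') (sym (re-powerSum ζ q)))
    conclude : q ≡ 0 × l ≡ 0ᴿ × 1ᴿ -ᴿ l' ≡ 0ᴿ → pointOn (next^ (suc q) i) l ≡ pointOn i l'
    conclude (refl , refl , 1-l'≡0) = begin
      pointOn (next i) 0ᴿ   ≡⟨ pointOn-0 (next i) ⟩
      V (next i)            ≡⟨ sym (pointOn-1 i) ⟩
      pointOn i 1ᴿ          ≡⟨ cong (pointOn i) (x-y≡0⇒x≡y 1-l'≡0) ⟩
      pointOn i l'          ∎

  perpendicular-backward-degenerate : ∀ q i {l l'} → suc (suc q) ≤ k → 0ᴿ ≤ᴿ l → l ≤ᴿ 1ᴿ → 0ᴿ ≤ᴿ l' →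
    dot (pointOn i l ⊖ pointOn (next^ (suc q) i) l') (edge (next^ (suc q) i)) ≡ 0ᴿ →
    pointOn i l ≡ pointOn (next^ (suc q) i) l'
  perpendicular-backward-degenerate q i {l} {l'} q<k 0≤l l≤1 0≤l' perp =
    conclude (rePartialSum-blend≡0 q q<k (x≤1⇒0≤1-x l≤1) (subst (0ᴿ ≤ᴿ_) l≡1-[1-l] 0≤l) 0≤l'
                                   (trans blend≡ -X≡0))
    where
    a c : Carrier
    a = rePartialSum ζ q
    c = re (ζ ^ suc q)
    l≡1-[1-l] : l ≡ 1ᴿ -ᴿ (1ᴿ -ᴿ l)
    l≡1-[1-l] = solve 1 (λ l → l := :1 :- (:1 :- l)) refl l
    blend≡ : ((1ᴿ -ᴿ (1ᴿ -ᴿ l)) *ᴿ a +ᴿ (1ᴿ -ᴿ l) *ᴿ (a +ᴿ c)) +ᴿ l' ≡ -ᴿ ((l *ᴿ c -ᴿ (a +ᴿ c)) -ᴿ l')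
    blend≡ = solve 4 (λ a c l l' → ((:1 :- (:1 :- l)) :* a :+ (:1 :- l) :* (a :+ c)) :+ l'
                                := :- ((l :* c :- (a :+ c)) :- l')) refl a c l l'
    -X≡0 : -ᴿ ((l *ᴿ c -ᴿ (a +ᴿ c)) -ᴿ l') ≡ 0ᴿ
    -X≡0 = trans (cong -ᴿ_ (perpendicular-backward (suc q) i l l' perp)) (solve 0 (:- :0 := :0) refl)
    conclude : q ≡ 0 × 1ᴿ -ᴿ l ≡ 0ᴿ × l' ≡ 0ᴿ → pointOn i l ≡ pointOn (next^ (suc q) i) l'
    conclude (refl , 1-l≡0 , refl) = begin
      pointOn i l           ≡⟨ cong (pointOn i) (sym (x-y≡0⇒x≡y 1-l≡0)) ⟩
      pointOn i 1ᴿ          ≡⟨ pointOn-1 i ⟩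
      V (next i)            ≡⟨ sym (pointOn-0 (next i)) ⟩
      pointOn (next i) 0ᴿ   ∎

  wrap-around : ∀ {r} i → suc k < r → r < suc (2 * k) →
                ∃ λ q → suc (suc q) ≤ k × next^ (suc q) (next^ r i) ≡ i
  wrap-around {r} i k+1<r r<n = d , d+2≤k , (begin
    next^ (suc d) (next^ r i)   ≡⟨ sym (next^-+ (suc d) r i) ⟩
    next^ (suc (d + r)) i       ≡⟨ cong (λ e → next^ (suc e) i) d+r≡2k ⟩
    next^ (suc (2 * k)) i       ≡⟨ next^-period i ⟩
    i                           ∎)
    where
    d : ℕ
    d = 2 * k ∸ r
    d+r≡2k : d + r ≡ 2 * k
    d+r≡2k = ℕ.m∸n+n≡m (ℕ.≤-pred r<n)
    d+2≤k : suc (suc d) ≤ k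
    d+2≤k = ℕ.+-cancelʳ-≤ k (suc (suc d)) k
      (subst₂ _≤_ (trans (ℕ.+-suc d (suc k)) (cong suc (ℕ.+-suc d k))) (trans d+r≡2k 2k≡k+k)
                  (ℕ.+-monoʳ-≤ d k+1<r))

  perpendicular-step : ∀ {i i' l l'} → 0ᴿ ≤ᴿ l → l ≤ᴿ 1ᴿ → 0ᴿ ≤ᴿ l' → l' ≤ᴿ 1ᴿ →
    pointOn i' l ≢ pointOn i l' → dot (pointOn i' l ⊖ pointOn i l') (edge i) ≡ 0ᴿ →
    i' ≡ next^ k i ⊎ i' ≡ next^ (suc k) i
  perpendicular-step {i} {i'} {l} {l'} 0≤l l≤1 0≤l' l'≤1 nondeg perp with next^-surjective i i'
  ... | r , r<n , refl with ℕ.<-cmp r k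
  ... | tri≈ _ r≡k _ = inj₁ (cong (λ e → next^ e i) r≡k)
  ... | tri< r<k _ _ = ⊥-elim (nondeg (short r r<k perp))
    where
    short : ∀ r → r < k → dot (pointOn (next^ r i) l ⊖ pointOn i l') (edge i) ≡ 0ᴿ →
            pointOn (next^ r i) l ≡ pointOn i l'
    short zero    _   = perpendicular-same-side i
    short (suc q) r<k = perpendicular-forward-degenerate q i r<k 0≤l l≤1 l'≤1
  ... | tri> _ _ k<r with ℕ.<-cmp r (suc k)
  ...   | tri≈ _ r≡k+1 _ = inj₂ (cong (λ e → next^ e i) r≡k+1)
  ...   | tri< r<k+1 _ _ = ⊥-elim (ℕ.<⇒≱ k<r (ℕ.≤-pred r<k+1))
  ...   | tri> _ _ k+1<r with wrap-around i k+1<r r<n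
  ...     | q , q<k , back = ⊥-elim (nondeg (subst (λ x → pointOn (next^ r i) l ≡ pointOn x l') back
             (perpendicular-backward-degenerate q (next^ r i) q<k 0≤l l≤1 0≤l'
               (subst (λ x → dot (pointOn (next^ r i) l ⊖ pointOn x l') (edge x) ≡ 0ᴿ) (sym back) perp))))

-- (2t+1)k + a lies strictly between t(2k+1) and (t+1)(2k+1).
[2t+1]k+a≢q[2k+1] : ∀ {t k} q a → t < k → a ≤ suc (2 * t) → suc (2 * t) * k + a ≢ q * suc (2 * k)
[2t+1]k+a≢q[2k+1] {t} {k} q a t<k a≤2t+1 eq = ℕ.<⇒≱ t<q (ℕ.≤-pred q<1+t)
  where
  open ℕ.≤-Reasoning
  t<q : t < q
  t<q = ℕ.*-cancelʳ-< (suc (2 * k)) t q (begin-strict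
    t * suc (2 * k)          ≡⟨ ℕ-Solver.solve (t ∷ k ∷ []) ⟩
    2 * (t * k) + t          <⟨ ℕ.+-monoʳ-< (2 * (t * k)) t<k ⟩
    2 * (t * k) + k          ≡⟨ ℕ-Solver.solve (t ∷ k ∷ []) ⟩
    suc (2 * t) * k          ≤⟨ ℕ.m≤m+n _ a ⟩
    suc (2 * t) * k + a      ≡⟨ eq ⟩
    q * suc (2 * k)          ∎)
  q<1+t : q < suc t
  q<1+t = ℕ.*-cancelʳ-< (suc (2 * k)) q (suc t) (begin-strict
    q * suc (2 * k)                  ≡⟨ sym eq ⟩
    suc (2 * t) * k + a              ≤⟨ ℕ.+-monoʳ-≤ (suc (2 * t) * k) a≤2t+1 ⟩
    suc (2 * t) * k + suc (2 * t)    ≡⟨ ℕ-Solver.solve (t ∷ k ∷ []) ⟩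
    suc (2 * (t * k) + t + k) + t    <⟨ ℕ.+-monoʳ-< _ t<k ⟩
    suc (2 * (t * k) + t + k) + k    ≡⟨ ℕ-Solver.solve (t ∷ k ∷ []) ⟩
    suc t * suc (2 * k)              ∎)

StepsBy : ∀ {p m} → ℕ → (Fin (suc p) → Fin (suc m)) → Set
StepsBy {m = m} k s = ∀ j → s (next j) ≡ next^ k (s j) ⊎ s (next j) ≡ next^ (suc k) (s j)
  where open CyclicShift m

module _ {p m k : ℕ} (s : Fin (suc p) → Fin (suc m)) (steps : StepsBy k s) where
  open CyclicShift m
  open ≡-Reasoning
  private
    module Orbit = CyclicShift p

    step : ∀ j → ∃ λ ε → ε ≤ 1 × s (next j) ≡ next^ (ε + k) (s j)
    step j with steps j
    ... | inj₁ s[j+1]≡ = 0 , z≤n , s[j+1]≡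
    ... | inj₂ s[j+1]≡ = 1 , s≤s z≤n , s[j+1]≡

  drift : ∀ J j → ∃ λ a → a ≤ J × s (Orbit.next^ J j) ≡ next^ (J * k + a) (s j)
  drift zero    j = 0 , z≤n , refl
  drift (suc J) j with drift J j | step (Orbit.next^ J j)
  ... | a , a≤J , s[J]≡ | ε , ε≤1 , s[J+1]≡ =
    a + ε , subst (_≤ suc J) (ℕ.+-comm ε a) (ℕ.+-mono-≤ ε≤1 a≤J) , (begin
      s (next (Orbit.next^ J j))                 ≡⟨ s[J+1]≡ ⟩
      next^ (ε + k) (s (Orbit.next^ J j))        ≡⟨ cong (next^ (ε + k)) s[J]≡ ⟩
      next^ (ε + k) (next^ (J * k + a) (s j))    ≡⟨ sym (next^-+ (ε + k) (J * k + a) (s j)) ⟩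
      next^ (ε + k + (J * k + a)) (s j)          ≡⟨ cong (λ e → next^ e (s j)) shift≡ ⟩
      next^ (suc J * k + (a + ε)) (s j)          ∎)
    where
    shift≡ : ε + k + (J * k + a) ≡ suc J * k + (a + ε)
    shift≡ = ℕ-Solver.solve (ε ∷ k ∷ J ∷ a ∷ [])

StepsBy⇒k≤t : ∀ {t k} (s : Fin (suc (2 * t)) → Fin (suc (2 * k))) → StepsBy k s → k ≤ t
StepsBy⇒k≤t {t} {k} s steps with drift {k = k} s steps (suc (2 * t)) Fin.zero
... | a , a≤2t+1 , s-returns
  with CyclicShift.next^-fixed⇒multiple (2 * k) (suc (2 * t) * k + a) (s Fin.zero)
         (trans (sym s-returns) (cong s (CyclicShift.next^-period (2 * t) Fin.zero)))
... | q , eq = ℕ.≮⇒≥ (λ t<k → [2t+1]k+a≢q[2k+1] q a t<k a≤2t+1 eq)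

proposition4p2 : (R : RealField) (k t : ℕ) → 1 ≤ k → 1 ≤ t → t < k →
    (Q : Geometry.RegularPolygon R (2 * k)) →
    (O : Geometry.RegularPolygon.PeriodicOrbit Q (2 * t)) →
    Geometry.RegularPolygon.PassesSide1 Q O →
    Geometry.RegularPolygon.VisitsThreeSides Q O → ⊥
proposition4p2 R k t _ _ t<k Q O _ _ = ℕ.<⇒≱ t<k (StepsBy⇒k≤t s steps)
  where
  open OddRegularPolygon R k Q
  open PeriodicOrbit O
  steps : StepsBy k s
  steps j with on-side j | on-side (next j)
  ... | l' , 0≤l' , l'≤1 , A≡ | l , 0≤l , l≤1 , B≡ =
    perpendicular-step 0≤l l≤1 0≤l' l'≤1 (λ B≡A → nondeg j (trans B≡ (trans B≡A (sym A≡))))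
      (subst₂ (λ X Y → dot (X ⊖ Y) (edge (s j)) ≡ 0ᴿ) B≡ A≡ (perp j))
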